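{- Let $a_0=0$ and, for $n\ge 1$, let $a_n$ be the $n$th entry of the infinite list $A$ defined below, and let $s_n=a_0+a_1+\cdots+a_n$. Let $(c_n)_{n\ge1}$ be the Conolly–Fox sequence, defined by $c_1=1$, $c_2=2$ and, for $n\ge 3$, \[ c_n=c_{n-c_{n-1}}+c_{n-1-c_{n-2}}. \] Then for each positive integer $n$, $s_n=4c_n+n$.
   Context: The list $A$: let $A_1=(5)$ and for $k\ge 2$ let $A_k$ be the concatenation $A_{k-1},A_{k-1},(1)$. Each $A_{k-1}$ is a prefix of $A_k$, and $A$ is the limiting infinite list (beginning $5,5,1,5,5,1,1,5,5,1,5,5,1,1,1,\dots$). -}

module Defs where

open import Data.Nat using (ℕ; zero; suc; _+_)
open import Data.List using (List; []; _∷_; _++_; [_])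

-- A k  is the finite list A_k of the paper (A 0 is an unused dummy).
-- A_1 = (5),  A_k = A_{k-1} ++ A_{k-1} ++ (1)  for k ≥ 2.
A : ℕ → List ℕ
A zero = []
A (suc zero) = [ 5 ]
A (suc (suc k)) = A (suc k) ++ A (suc k) ++ [ 1 ]

-- nth xs i : the i-th entry (1-indexed) of xs, default 0 if out of range.
nth : List ℕ → ℕ → ℕ
nth [] _ = 0
nth (x ∷ xs) zero = 0
nth (x ∷ xs) (suc zero) = x
nth (x ∷ xs) (suc (suc i)) = nth xs (suc i)

-- a_0 = 0, and for n ≥ 1, a_n = n-th entry of the limit list A.
-- Since A_{k-1} is a prefix of A_k and |A_n| = 2^n - 1 ≥ n, the n-th entry
-- of the limit list equals the n-th entry of A_n.
a : ℕ → ℕ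
a zero = 0
a (suc n) = nth (A (suc n)) (suc n)

s : ℕ → ℕ
s zero = a zero
s (suc n) = s n + a (suc n)

-- Encode 5 as true and 1 as false.  The word W k with A (suc k) = map weight (W k)
-- is then also σ^k (true), for the substitution σ : true ↦ true true false, false ↦ false,
-- so s n = 4 F n + n where F n counts the trues among the first n letters of the
-- limit word.  In σ w every block σ x ends with its only false, so the number of
-- falses among the first n letters of σ w is the number of complete blocks there.
-- Hence if the j-th letter of w is true, the first true of its block lies among the
-- first n letters iff j ≤ 1 + #false (n - 1), and the second iff j ≤ 1 + #false (n - 2);
-- summing over j gives the Conolly–Fox recurrence for F, which determines F.
module Submission where

open import Defs
open import Data.Nat using (ℕ; _+_; _*_; _∸_; _≤_; zero; suc; z≤n; s≤s; _<_; _≤′_; ≤′-refl; ≤′-step)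
open import Relation.Binary.PropositionalEquality using (_≡_; refl; sym; trans; cong; cong₂; subst; module ≡-Reasoning)
open import Data.Bool using (Bool; true; false; not; if_then_else_)
open import Data.List using (List; []; _∷_; _++_; [_]; map; length)
open import Data.List.Properties using (map-++; ++-assoc; ++-identityʳ; length-++; length-++-≤ʳ)
open import Data.Nat.Induction using (<-rec)
open import Data.Nat.Properties
open import Algebra.Properties.CommutativeSemigroup +-commutativeSemigroup using (xy∙z≈xz∙y)
open import Data.Product using (∃-syntax; _×_; _,_)
open import Data.Sum using (inj₁; inj₂)
open import Function using (id)
open ≡-Reasoning

σ : List Bool → List Bool
σ [] = []
σ (true ∷ w) = true ∷ true ∷ false ∷ σ w
σ (false ∷ w) = false ∷ σ w

σ-++ : ∀ u v → σ (u ++ v) ≡ σ u ++ σ v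
σ-++ [] v = refl
σ-++ (true ∷ u) v = cong (λ w → true ∷ true ∷ false ∷ w) (σ-++ u v)
σ-++ (false ∷ u) v = cong (false ∷_) (σ-++ u v)

count : (Bool → Bool) → List Bool → ℕ → ℕ
count p w zero = 0
count p [] (suc n) = 0
count p (x ∷ w) (suc n) = if p x then suc (count p w n) else count p w n

#true #false : List Bool → ℕ → ℕ
#true = count id
#false = count not

count-≤ : ∀ p w n → count p w n ≤ n
count-≤ p w zero = z≤n
count-≤ p [] (suc n) = z≤n
count-≤ p (x ∷ w) (suc n) with p x
... | true = s≤s (count-≤ p w n)
... | false = m≤n⇒m≤1+n (count-≤ p w n)

count-++ : ∀ p u v n → n ≤ length u → count p (u ++ v) n ≡ count p u n
count-++ p u v zero _ = refl
count-++ p (x ∷ u) v (suc n) (s≤s n≤∣u∣) =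
  cong (λ k → if p x then suc k else k) (count-++ p u v n n≤∣u∣)

#true+#false : ∀ w n → n ≤ length w → #true w n + #false w n ≡ n
#true+#false w zero _ = refl
#true+#false (true ∷ w) (suc n) (s≤s n≤∣w∣) = cong suc (#true+#false w n n≤∣w∣)
#true+#false (false ∷ w) (suc n) (s≤s n≤∣w∣) =
  trans (+-suc (#true w n) (#false w n)) (cong suc (#true+#false w n n≤∣w∣))

#true-σ-1 : ∀ w → #true (σ w) 1 ≡ #true w 1
#true-σ-1 [] = refl
#true-σ-1 (true ∷ w) = refl
#true-σ-1 (false ∷ w) = refl

#true-σ : ∀ w n → #true (σ w) (2 + n)
                ≡ #true w (suc (#false (σ w) (suc n))) + #true w (suc (#false (σ w) n))
#true-σ [] n = refl
#true-σ (false ∷ w) zero = trans (#true-σ-1 w) (sym (+-identityʳ (#true w 1)))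
#true-σ (false ∷ w) (suc n) = #true-σ w n
#true-σ (true ∷ w) zero = refl
#true-σ (true ∷ w) 1 = refl
#true-σ (true ∷ w) 2 = cong suc (trans (cong suc (#true-σ-1 w)) (+-comm 1 (#true w 1)))
#true-σ (true ∷ w) (suc (suc (suc n))) =
  trans (cong (2 +_) (#true-σ w n)) (sym (+-suc (suc (#true w (suc i))) (#true w (suc j))))
  where
  i j : ℕ
  i = #false (σ w) (suc n)
  j = #false (σ w) n

weight : Bool → ℕ
weight true = 5
weight false = 1

weight-step : ∀ w n → suc n ≤ length w
            → 4 * #true w n + nth (map weight w) (suc n) ≡ 4 * #true w (suc n) + 1
weight-step (true ∷ w) zero _ = refl
weight-step (false ∷ w) zero _ = refl
weight-step (false ∷ w) (suc n) (s≤s n<∣w∣) = weight-step w n n<∣w∣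
weight-step (true ∷ w) (suc n) (s≤s n<∣w∣) = begin
  4 * suc t + b      ≡⟨ cong (_+ b) (*-suc 4 t) ⟩
  4 + 4 * t + b      ≡⟨ +-assoc 4 (4 * t) b ⟩
  4 + (4 * t + b)    ≡⟨ cong (4 +_) (weight-step w n n<∣w∣) ⟩
  4 + (4 * t′ + 1)   ≡⟨ cong (_+ 1) (sym (*-suc 4 t′)) ⟩
  4 * suc t′ + 1     ∎
  where
  t t′ b : ℕ
  t = #true w n
  t′ = #true w (suc n)
  b = nth (map weight w) (suc n)

W : ℕ → List Bool
W zero = [ true ]
W (suc k) = W k ++ W k ++ [ false ]

A≡map-weight-W : ∀ k → A (suc k) ≡ map weight (W k)
A≡map-weight-W zero = refl
A≡map-weight-W (suc k) = begin
  A (suc k) ++ A (suc k) ++ [ 1 ]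
    ≡⟨ cong (λ u → u ++ u ++ [ 1 ]) (A≡map-weight-W k) ⟩
  map weight (W k) ++ map weight (W k) ++ [ 1 ]
    ≡⟨ cong (map weight (W k) ++_) (sym (map-++ weight (W k) [ false ])) ⟩
  map weight (W k) ++ map weight (W k ++ [ false ])
    ≡⟨ sym (map-++ weight (W k) (W k ++ [ false ])) ⟩
  map weight (W (suc k)) ∎

σ-W : ∀ k → σ (W k) ≡ W (suc k)
σ-W zero = refl
σ-W (suc k) = begin
  σ (W k ++ W k ++ [ false ])       ≡⟨ σ-++ (W k) (W k ++ [ false ]) ⟩
  σ (W k) ++ σ (W k ++ [ false ])   ≡⟨ cong (σ (W k) ++_) (σ-++ (W k) [ false ]) ⟩
  σ (W k) ++ σ (W k) ++ [ false ]   ≡⟨ cong (λ u → u ++ u ++ [ false ]) (σ-W k) ⟩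
  W (suc k) ++ W (suc k) ++ [ false ] ∎

W-head : ∀ k → ∃[ w ] W k ≡ true ∷ w
W-head zero = [] , refl
W-head (suc k) with W-head k
... | w , eq = w ++ W k ++ [ false ] , cong (_++ W k ++ [ false ]) eq

W-prefix : ∀ {j k} → j ≤′ k → ∃[ v ] W k ≡ W j ++ v
W-prefix {j} ≤′-refl = [] , sym (++-identityʳ (W j))
W-prefix {j} (≤′-step {k} j≤′k) with W-prefix j≤′k
... | v , eq = v ++ W k ++ [ false ] , (begin
  W k ++ W k ++ [ false ]          ≡⟨ cong (_++ W k ++ [ false ]) eq ⟩
  (W j ++ v) ++ W k ++ [ false ]   ≡⟨ ++-assoc (W j) v (W k ++ [ false ]) ⟩
  W j ++ v ++ W k ++ [ false ]     ∎)

n<length-W : ∀ n → n < length (W n)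
n<length-W zero = s≤s z≤n
n<length-W (suc n) =
  ≤-trans (s≤s (n<length-W n))
    (≤-trans (≤-reflexive (trans (+-comm 1 (length (W n))) (sym (length-++ (W n)))))
             (length-++-≤ʳ (W n ++ [ false ]) {W n}))

count-W : ∀ p k n → n ≤ length (W k) → count p (W k) n ≡ count p (W n) n
count-W p k n n≤∣Wk∣ with ≤-total k n
... | inj₁ k≤n with W-prefix (≤⇒≤′ k≤n)
...   | v , eq = sym (trans (cong (λ u → count p u n) eq) (count-++ p (W k) v n n≤∣Wk∣))
count-W p k n n≤∣Wk∣ | inj₂ n≤k with W-prefix (≤⇒≤′ n≤k)
...   | v , eq = trans (cong (λ u → count p u n) eq)
                       (count-++ p (W n) v n (<⇒≤ (n<length-W n)))

-- Since n < length (W n), W n determines the first n letters of the limit word.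
F G : ℕ → ℕ
F n = #true (W n) n
G n = #false (W n) n

F+G : ∀ n → F n + G n ≡ n
F+G n = #true+#false (W n) n (<⇒≤ (n<length-W n))

F-bounds : ∀ n → 1 ≤ F (suc n) × F (suc n) ≤ suc n
F-bounds n with W-head (suc n)
... | w , eq = subst (λ u → 1 ≤ #true u (suc n)) (sym eq) (s≤s z≤n) , count-≤ id (W (suc n)) (suc n)

suc-∸-F : ∀ n → suc n ∸ F n ≡ suc (G n)
suc-∸-F n = begin
  suc n ∸ F n          ≡⟨ +-∸-assoc 1 (count-≤ id (W n) n) ⟩
  suc (n ∸ F n)        ≡⟨ cong (λ m → suc (m ∸ F n)) (sym (F+G n)) ⟩
  suc (F n + G n ∸ F n) ≡⟨ cong suc (m+n∸m≡n (F n) (G n)) ⟩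
  suc (G n)            ∎

F-rec : ∀ n → F (2 + n) ≡ F (suc (G (suc n))) + F (suc (G n))
F-rec n = begin
  #true (W (2 + n)) (2 + n)
    ≡⟨ cong (λ u → #true u (2 + n)) (sym (σ-W (suc n))) ⟩
  #true (σ W′) (2 + n)
    ≡⟨ #true-σ W′ n ⟩
  #true W′ (suc (#false (σ W′) (suc n))) + #true W′ (suc (#false (σ W′) n))
    ≡⟨ cong (λ u → #true W′ (suc (#false u (suc n))) + #true W′ (suc (#false u n))) (σ-W (suc n)) ⟩
  #true W′ (suc (#false (W (2 + n)) (suc n))) + #true W′ (suc (#false (W (2 + n)) n))
    ≡⟨ cong₂ (λ i j → #true W′ (suc i) + #true W′ (suc j))
             (count-W not (2 + n) (suc n) ∣W∣≥) (count-W not (2 + n) n (≤-trans (n≤1+n n) ∣W∣≥)) ⟩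
  #true W′ (suc (G (suc n))) + #true W′ (suc (G n))
    ≡⟨ cong₂ _+_ (count-W id (suc n) (suc (G (suc n))) (in-range (suc n) ≤-refl))
                 (count-W id (suc n) (suc (G n)) (in-range n (n≤1+n n))) ⟩
  F (suc (G (suc n))) + F (suc (G n)) ∎
  where
  W′ : List Bool
  W′ = W (suc n)
  ∣W∣≥ : suc n ≤ length (W (2 + n))
  ∣W∣≥ = ≤-trans (n≤1+n (suc n)) (<⇒≤ (n<length-W (2 + n)))
  in-range : ∀ m → m ≤ suc n → suc (G m) ≤ length (W (suc n))
  in-range m m≤ = ≤-trans (s≤s (≤-trans (count-≤ not (W m) m) m≤)) (n<length-W (suc n))

s≡4F+n : ∀ n → s n ≡ 4 * F n + n
s≡4F+n zero = refl
s≡4F+n (suc n) = begin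
  s n + nth (A (suc n)) (suc n)
    ≡⟨ cong₂ _+_ (s≡4F+n n) (cong (λ l → nth l (suc n)) (A≡map-weight-W n)) ⟩
  4 * F n + n + nth (map weight (W n)) (suc n)
    ≡⟨ xy∙z≈xz∙y (4 * F n) n _ ⟩
  4 * F n + nth (map weight (W n)) (suc n) + n
    ≡⟨ cong (_+ n) (weight-step (W n) n (n<length-W n)) ⟩
  4 * #true (W n) (suc n) + 1 + n
    ≡⟨ +-assoc (4 * #true (W n) (suc n)) 1 n ⟩
  4 * #true (W n) (suc n) + suc n
    ≡⟨ cong (λ t → 4 * t + suc n) (count-W id n (suc n) (n<length-W n)) ⟩
  4 * F (suc n) + suc n ∎

ConollyFoxRecurrence : (ℕ → ℕ) → Set
ConollyFoxRecurrence c = ∀ n → 3 ≤ n → c n ≡ c (n ∸ c (n ∸ 1)) + c (n ∸ 1 ∸ c (n ∸ 2))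

F-conollyFox : ConollyFoxRecurrence F
F-conollyFox 1 (s≤s ())
F-conollyFox 2 (s≤s (s≤s ()))
F-conollyFox (suc (suc (suc n))) _ = begin
  F (3 + n)                                  ≡⟨ F-rec (suc n) ⟩
  F (suc (G (2 + n))) + F (suc (G (suc n)))  ≡⟨ sym (cong₂ _+_ (cong F (suc-∸-F (2 + n)))
                                                                (cong F (suc-∸-F (suc n)))) ⟩
  F (3 + n ∸ F (2 + n)) + F (2 + n ∸ F (suc n)) ∎

-- The bounds on d keep every argument of the recurrence in [1, n), so strong
-- induction applies.
conollyFox-unique : ∀ {c d} → c 1 ≡ d 1 → c 2 ≡ d 2
                  → ConollyFoxRecurrence c → ConollyFoxRecurrence d
                  → (∀ n → 1 ≤ d (suc n) × d (suc n) ≤ suc n)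
                  → ∀ n → c (suc n) ≡ d (suc n)
conollyFox-unique {c} {d} c1 c2 c-rec d-rec d-bounds = <-rec (λ n → c (suc n) ≡ d (suc n)) step
  where
  step : ∀ n → (∀ {m} → m < n → c (suc m) ≡ d (suc m)) → c (suc n) ≡ d (suc n)
  step zero _ = c1
  step (suc zero) _ = c2
  step (suc (suc n)) ih = begin
    c (3 + n)                                     ≡⟨ c-rec (3 + n) (s≤s (s≤s (s≤s z≤n))) ⟩
    c (3 + n ∸ c (2 + n)) + c (2 + n ∸ c (suc n))
      ≡⟨ cong₂ (λ x y → c (3 + n ∸ x) + c (2 + n ∸ y)) (ih ≤-refl) (ih (n≤1+n (suc n))) ⟩
    c (3 + n ∸ d (2 + n)) + c (2 + n ∸ d (suc n))
      ≡⟨ cong₂ _+_ (agree (suc n) ≤-refl) (agree n (n≤1+n n)) ⟩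
    d (3 + n ∸ d (2 + n)) + d (2 + n ∸ d (suc n)) ≡⟨ sym (d-rec (3 + n) (s≤s (s≤s (s≤s z≤n)))) ⟩
    d (3 + n) ∎
    where
    agree : ∀ j → j ≤ suc n → c (2 + j ∸ d (suc j)) ≡ d (2 + j ∸ d (suc j))
    agree j j≤ with d-bounds j
    ... | 1≤d , d≤ = subst (λ i → c i ≡ d i) (sym (+-∸-assoc 1 d≤))
                       (ih (s≤s (≤-trans (∸-monoʳ-≤ (suc j) 1≤d) j≤)))

theorem6p1 : (c : ℕ → ℕ) → c 1 ≡ 1 → c 2 ≡ 2
    → (∀ n → 3 ≤ n → c n ≡ c (n ∸ c (n ∸ 1)) + c (n ∸ 1 ∸ c (n ∸ 2)))
    → ∀ n → 1 ≤ n → s n ≡ 4 * c n + n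
theorem6p1 c c1 c2 c-rec (suc n) _ = begin
  s (suc n)              ≡⟨ s≡4F+n (suc n) ⟩
  4 * F (suc n) + suc n  ≡⟨ cong (λ x → 4 * x + suc n)
                                (sym (conollyFox-unique c1 c2 c-rec F-conollyFox F-bounds n)) ⟩
  4 * c (suc n) + suc n  ∎
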